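{- Let $a,b,\ell,m,w$ be positive integers with $\ell a=mb=w$. Let $\boldsymbol{\lambda}$ be the partition of $w$ consisting of $\ell$ copies of $a$, let $\boldsymbol{\mu}$ be the partition of $w$ consisting of $m$ copies of $b$, and let $\Gamma$ be a directed cycle of length $w$. Then (a) the number of isomorphism classes of $(\boldsymbol{\lambda},\boldsymbol{\mu})$-tilings of $\Gamma$ is $\gcd(a,b)$; (b) for every $(\boldsymbol{\lambda},\boldsymbol{\mu})$-tiling $(S,T)$ of $\Gamma$, the order of $\mathrm{Aut}(\Gamma,S,T)$ is $\gcd(\ell,m)$.
   Context: A partition of $w$ is a multiset of positive integers with sum $w$. For a directed cycle (or more generally a disjoint union of directed cycles) $\Gamma$ with $w$ vertices and a partition $\boldsymbol{\lambda}$ of $w$, a $\boldsymbol{\lambda}$-tiling of $\Gamma$ is a set $S$ of subgraphs of $\Gamma$, each a directed path of length $\ge0$, whose vertex sets partition $V(\Gamma)$ and whose multiset of vertex counts equals $\boldsymbol{\lambda}$. A $(\boldsymbol{\lambda},\boldsymbol{\mu})$-tiling is an ordered pair $(S,T)$ with $S$ a $\boldsymbol{\lambda}$-tiling and $T$ a $\boldsymbol{\mu}$-tiling of $\Gamma$. $\mathrm{Aut}(\Gamma,S,T)$ is the group of digraph automorphisms of $\Gamma$ carrying $S$ onto $S$ and $T$ onto $T$; two tilings $(S,T)$, $(S',T')$ are isomorphic if some digraph automorphism of $\Gamma$ carries $S$ onto $S'$ and $T$ onto $T'$. -}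

module Defs where

open import Data.Nat as ℕ using (ℕ; zero; suc; _≤_; _<_)
open import Data.Nat.DivMod using (_mod_)
open import Data.Fin using (Fin; toℕ)
open import Data.Product using (Σ; ∃; ∃₂; _×_; _,_; proj₁; proj₂)
open import Data.List using (List; map)
open import Data.List.Membership.Propositional using (_∈_)
open import Data.List.Relation.Unary.Unique.Propositional using (Unique)
open import Data.List.Relation.Binary.Permutation.Propositional using (_↭_)
open import Relation.Binary.PropositionalEquality using (_≡_)
open import Function.Bundles using (_↔_; _⇔_; Inverse)

next : ∀ {w} → Fin w → Fin w
next {suc n} i = (toℕ i ℕ.+ 1) mod (suc n)

Arc : ∀ {w} → Fin w → Fin w → Set
Arc u v = v ≡ next u

_⊕_ : ∀ {w} → Fin w → ℕ → Fin w
i ⊕ zero = i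
i ⊕ suc j = next (i ⊕ j)

-- A directed path subgraph of the
-- cycle is determined by its first vertex s and its number of vertices
-- k, with 1 ≤ k ≤ w (distinct valid codes give distinct subgraphs).

Tile : ℕ → Set
Tile w = Fin w × ℕ

start : ∀ {w} → Tile w → Fin w
start = proj₁

size : ∀ {w} → Tile w → ℕ
size = proj₂

InV : ∀ {w} → Tile w → Fin w → Set
InV (s , k) v = ∃ λ j → j < k × v ≡ s ⊕ j

InE : ∀ {w} → Tile w → Fin w → Fin w → Set
InE (s , k) u v = ∃ λ j → suc j < k × u ≡ s ⊕ j × v ≡ s ⊕ suc j

record IsTiling (w : ℕ) (λs : List ℕ) (S : List (Tile w)) : Set where
  field
    unique   : Unique S
    valid    : ∀ t → t ∈ S → 1 ≤ size t × size t ≤ w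
    cover    : ∀ v → ∃ λ t → t ∈ S × InV t v
    disjoint : ∀ t t' v → t ∈ S → t' ∈ S → InV t v → InV t' v → t ≡ t'
    sizes    : map size S ↭ λs

record BiTiling (w : ℕ) (λs μs : List ℕ) : Set where
  constructor bitiling
  field
    S : List (Tile w)
    T : List (Tile w)
    S-tiling : IsTiling w λs S
    T-tiling : IsTiling w μs T

record Aut (w : ℕ) : Set where
  field
    perm : Fin w ↔ Fin w
    arcs : ∀ u v → Arc u v ⇔ Arc (Inverse.to perm u) (Inverse.to perm v)

app : ∀ {w} → Aut w → Fin w → Fin w
app f = Inverse.to (Aut.perm f)

ImageIs : ∀ {w} → Aut w → Tile w → Tile w → Set
ImageIs f t t' =
  (∀ v → (∃ λ x → InV t x × app f x ≡ v) ⇔ InV t' v) ×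
  (∀ u v → (∃₂ λ x y → InE t x y × app f x ≡ u × app f y ≡ v) ⇔ InE t' u v)

Carries : ∀ {w} → Aut w → List (Tile w) → List (Tile w) → Set
Carries f S S' =
  (∀ t → t ∈ S → ∃ λ t' → t' ∈ S' × ImageIs f t t') ×
  (∀ t' → t' ∈ S' → ∃ λ t → t ∈ S × ImageIs f t t')

Iso : ∀ {w λs μs} → BiTiling w λs μs → BiTiling w λs μs → Set
Iso {w} P Q = ∃ λ (f : Aut w) →
  Carries f (BiTiling.S P) (BiTiling.S Q) × Carries f (BiTiling.T P) (BiTiling.T Q)

AutOf : ∀ {w λs μs} → BiTiling w λs μs → Set
AutOf {w} P = Σ (Aut w) λ f →
  Carries f (BiTiling.S P) (BiTiling.S P) × Carries f (BiTiling.T P) (BiTiling.T P)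

SameAut : ∀ {w λs μs} {P : BiTiling w λs μs} → AutOf P → AutOf P → Set
SameAut {w} f g = ∀ (x : Fin w) → app (proj₁ f) x ≡ app (proj₁ g) x

-- "A has exactly n classes w.r.t. the equivalence R": there are n
-- pairwise R-inequivalent representatives and every element is
-- R-related to one of them.  (With R = equality this is |A| = n.)

HasNClasses : (A : Set) → (A → A → Set) → ℕ → Set
HasNClasses A R n = Σ (Fin n → A) λ rep →
  (∀ i j → R (rep i) (rep j) → i ≡ j) × (∀ x → ∃ λ i → R x (rep i))

-- Every automorphism of the directed cycle is a rotation x ↦ x + r, and a tiling by ℓ paths with
-- a vertices each is the grid s + aℤ of starting vertices, determined by any one of its tiles.
-- A rotation by r carries the grid s + aℤ onto s' + aℤ iff r ≡ s' − s (mod a). So tilings (S, T)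
-- and (S', T') with starts s, t and s', t' are isomorphic iff r ≡ s' − s (mod a) and
-- r ≡ t' − t (mod b) for some r, which by Bézout means t − s ≡ t' − s' (mod gcd(a, b)); and
-- Aut(Γ, S, T) consists of the rotations by the multiples of lcm(a, b) = w / gcd(ℓ, m) below w.
module Submission where

open import Defs
open import Data.Nat
  using ( ℕ; zero; suc; pred; _+_; _*_; _≤_; _<_; s≤s; z≤n
        ; NonZero; ≢-nonZero; ≢-nonZero⁻¹; >-nonZero; >-nonZero⁻¹)
open import Data.Nat.Properties
open import Data.Nat.DivMod
open import Data.Nat.Divisibility
  using (_∣_; divides; ∣-trans; n∣m*n; ∣n⇒∣m*n; %-presˡ-∣; ∣n∣m%n⇒∣m; *-monoˡ-∣)
open import Data.Nat.GCD using (gcd; m/gcd[m,n]≢0; gcd[m,n]∣m; gcd[m,n]∣n; gcd[m,n]≢0; gcd-GCD; module Bézout)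
open import Data.Nat.Coprimality using (Coprime; coprime-/gcd; coprime-divisor)
open import Data.Nat.Tactic.RingSolver using (solve-∀)
open import Data.Fin as Fin using (Fin; toℕ; fromℕ<)
open import Data.Fin.Properties using (toℕ-fromℕ<; toℕ<n; toℕ-injective)
open import Data.Product using (∃; ∃₂; _×_; _,_; proj₁; proj₂)
open import Data.Sum using (inj₁)
open import Data.List using (List; replicate; tabulate; _∷_)
open import Data.List.Properties using (map-tabulate)
open import Data.List.Membership.Propositional using (_∈_)
open import Data.List.Membership.Propositional.Properties using (∈-map⁺; ∈-tabulate⁺; ∈-tabulate⁻)
import Data.List.Relation.Unary.All as All
open import Data.List.Relation.Unary.All.Properties using (replicate⁺)
open import Data.List.Relation.Unary.Unique.Propositional.Properties using (tabulate⁺)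
open import Data.List.Relation.Binary.Permutation.Propositional using (↭-reflexive)
open import Data.List.Relation.Binary.Permutation.Propositional.Properties using (∈-resp-↭)
open import Function.Bundles using (Equivalence; mk↔ₛ′; mk⇔)
open import Relation.Nullary using (¬_; contradiction)
open import Relation.Binary.PropositionalEquality
  using (_≡_; refl; sym; trans; cong; cong₂; subst; subst₂; module ≡-Reasoning)

[m%d+n]%d≡[m+n]%d : ∀ m n d .{{_ : NonZero d}} → (m % d + n) % d ≡ (m + n) % d
[m%d+n]%d≡[m+n]%d m n d = begin
  (m % d + n) % d          ≡⟨ %-distribˡ-+ (m % d) n d ⟩
  (m % d % d + n % d) % d  ≡⟨ cong (λ x → (x + n % d) % d) (m%n%n≡m%n m d) ⟩
  (m % d + n % d) % d      ≡⟨ %-distribˡ-+ m n d ⟨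
  (m + n) % d              ∎
  where open ≡-Reasoning

%-≡-divisor : ∀ {d n} x y .{{_ : NonZero d}} .{{_ : NonZero n}} →
              d ∣ n → x % n ≡ y % n → x % d ≡ y % d
%-≡-divisor {d} {n} x y d∣n eq = begin
  x % d      ≡⟨ m∣n⇒o%n%m≡o%m d n x d∣n ⟨
  x % n % d  ≡⟨ cong (_% d) eq ⟩
  y % n % d  ≡⟨ m∣n⇒o%n%m≡o%m d n y d∣n ⟩
  y % d      ∎
  where open ≡-Reasoning

gcd≢0 : ∀ m n .{{_ : NonZero m}} → NonZero (gcd m n)
gcd≢0 m n = ≢-nonZero (gcd[m,n]≢0 m n (inj₁ (≢-nonZero⁻¹ m)))

-- In the +- case g + y·b = x·a, and the identity is q·(b − 1) times it plus q·g.
u*a+q*gcd≡k*b : ∀ a b q .{{_ : NonZero b}} → ∃₂ λ u k → u * a + q * gcd a b ≡ k * b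
u*a+q*gcd≡k*b a b@(suc b-1) q with Bézout.identity (gcd-GCD a b)
... | Bézout.-+ x y eq = q * x , q * y , (begin
  q * x * a + q * g      ≡⟨ rearrange q x a g ⟩
  q * (g + x * a)        ≡⟨ cong (q *_) eq ⟩
  q * (y * b)            ≡⟨ *-assoc q y b ⟨
  q * y * b              ∎)
  where
  open ≡-Reasoning
  g = gcd a b
  rearrange : ∀ q x a g → q * x * a + q * g ≡ q * (g + x * a)
  rearrange = solve-∀
... | Bézout.+- x y eq = q * b-1 * x , q * g + q * b-1 * y , (begin
  q * b-1 * x * a + q * g      ≡⟨ cong (_+ q * g) (*-assoc (q * b-1) x a) ⟩
  q * b-1 * (x * a) + q * g    ≡⟨ cong (λ z → q * b-1 * z + q * g) eq ⟨
  q * b-1 * (g + y * b) + q * g ≡⟨ rearrange q b-1 g y ⟩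
  (q * g + q * b-1 * y) * b    ∎)
  where
  open ≡-Reasoning
  g = gcd a b
  rearrange : ∀ q b-1 g y → q * b-1 * (g + y * suc b-1) + q * g ≡ (q * g + q * b-1 * y) * suc b-1
  rearrange = solve-∀

coprime-common-multiple-∣ : ∀ {e f a b x} .{{_ : NonZero a}} →
  Coprime e f → e * a ≡ f * b → a ∣ x → b ∣ x → e * a ∣ x
coprime-common-multiple-∣ {e} {f} {a} {b} coprime ea≡fb (divides X refl) (divides Y Xa≡Yb) =
  *-monoˡ-∣ a (coprime-divisor coprime (divides Y (*-cancelʳ-≡ (f * X) (Y * e) a (begin
    f * X * a      ≡⟨ *-assoc f X a ⟩
    f * (X * a)    ≡⟨ cong (f *_) Xa≡Yb ⟩
    f * (Y * b)    ≡⟨ x*[y*z]≡y*[x*z] f Y b ⟩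
    Y * (f * b)    ≡⟨ cong (Y *_) ea≡fb ⟨
    Y * (e * a)    ≡⟨ *-assoc Y e a ⟨
    Y * e * a      ∎))))
  where
  open ≡-Reasoning
  x*[y*z]≡y*[x*z] : ∀ x y z → x * (y * z) ≡ y * (x * z)
  x*[y*z]≡y*[x*z] = solve-∀

tabulate-const : ∀ {A : Set} ℓ (x : A) → tabulate {n = ℓ} (λ _ → x) ≡ replicate ℓ x
tabulate-const zero x = refl
tabulate-const (suc ℓ) x = cong (x ∷_) (tabulate-const ℓ x)

module Cycle (n : ℕ) where

  w : ℕ
  w = suc n

  vertex : ℕ → Fin w
  vertex j = Fin.zero ⊕ j

  toℕ-vertex : ∀ j → toℕ (vertex j) ≡ j % w
  toℕ-vertex zero = refl
  toℕ-vertex (suc j) = begin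
    toℕ (next (vertex j))      ≡⟨ toℕ-fromℕ< _ ⟩
    (toℕ (vertex j) + 1) % w   ≡⟨ cong (λ x → (x + 1) % w) (toℕ-vertex j) ⟩
    (j % w + 1) % w            ≡⟨ [m%d+n]%d≡[m+n]%d j 1 w ⟩
    (j + 1) % w                ≡⟨ cong (_% w) (+-comm j 1) ⟩
    suc j % w                  ∎
    where open ≡-Reasoning

  vertex-toℕ : ∀ (x : Fin w) → vertex (toℕ x) ≡ x
  vertex-toℕ x = toℕ-injective (trans (toℕ-vertex (toℕ x)) (m<n⇒m%n≡m (toℕ<n x)))

  ⊕-+ : ∀ (x : Fin w) i j → (x ⊕ i) ⊕ j ≡ x ⊕ (j + i)
  ⊕-+ x i zero = refl
  ⊕-+ x i (suc j) = cong next (⊕-+ x i j)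

  ⊕-swap : ∀ (x : Fin w) i j → (x ⊕ i) ⊕ j ≡ (x ⊕ j) ⊕ i
  ⊕-swap x i j = trans (⊕-+ x i j) (trans (cong (x ⊕_) (+-comm j i)) (sym (⊕-+ x j i)))

  toℕ-⊕ : ∀ (x : Fin w) j → toℕ (x ⊕ j) ≡ (toℕ x + j) % w
  toℕ-⊕ x j = begin
    toℕ (x ⊕ j)                ≡⟨ cong (λ y → toℕ (y ⊕ j)) (vertex-toℕ x) ⟨
    toℕ (vertex (toℕ x) ⊕ j)   ≡⟨ cong toℕ (⊕-+ Fin.zero (toℕ x) j) ⟩
    toℕ (vertex (j + toℕ x))   ≡⟨ toℕ-vertex (j + toℕ x) ⟩
    (j + toℕ x) % w            ≡⟨ cong (_% w) (+-comm j (toℕ x)) ⟩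
    (toℕ x + j) % w            ∎
    where open ≡-Reasoning

  ⊕-cong-% : ∀ (x : Fin w) i j → i % w ≡ j % w → x ⊕ i ≡ x ⊕ j
  ⊕-cong-% x i j eq = toℕ-injective (begin
    toℕ (x ⊕ i)               ≡⟨ toℕ-⊕ x i ⟩
    (toℕ x + i) % w           ≡⟨ %-distribˡ-+ (toℕ x) i w ⟩
    (toℕ x % w + i % w) % w   ≡⟨ cong (λ r → (toℕ x % w + r) % w) eq ⟩
    (toℕ x % w + j % w) % w   ≡⟨ %-distribˡ-+ (toℕ x) j w ⟨
    (toℕ x + j) % w           ≡⟨ toℕ-⊕ x j ⟨
    toℕ (x ⊕ j)               ∎)
    where open ≡-Reasoning

  ⊕-turns : ∀ (x : Fin w) c → x ⊕ (w * c) ≡ x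
  ⊕-turns x c = ⊕-cong-% x (w * c) 0 (trans (cong (_% w) (*-comm w c)) (m*n%n≡0 c w))

  -- Adding n * r undoes a rotation by r, since r + n * r = w * r.
  ⊕-inverseˡ : ∀ (x : Fin w) r → (x ⊕ (n * r)) ⊕ r ≡ x
  ⊕-inverseˡ x r = trans (⊕-+ x (n * r) r) (⊕-turns x r)

  ⊕-inverseʳ : ∀ (x : Fin w) r → (x ⊕ r) ⊕ (n * r) ≡ x
  ⊕-inverseʳ x r = trans (⊕-+ x r (n * r)) (trans (cong (x ⊕_) (+-comm (n * r) r)) (⊕-turns x r))

  ⊕-cancelʳ : ∀ r {x y : Fin w} → x ⊕ r ≡ y ⊕ r → x ≡ y
  ⊕-cancelʳ r {x} {y} eq = trans (sym (⊕-inverseʳ x r)) (trans (cong (_⊕ (n * r)) eq) (⊕-inverseʳ y r))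

  ⊕-negate : ∀ (x : Fin w) → x ⊕ (n * toℕ x) ≡ Fin.zero
  ⊕-negate x = trans (cong (_⊕ (n * toℕ x)) (sym (vertex-toℕ x))) (⊕-inverseʳ Fin.zero (toℕ x))

  ⊕-injective : ∀ (x : Fin w) i j → x ⊕ i ≡ x ⊕ j → i % w ≡ j % w
  ⊕-injective x i j eq = begin
    i % w              ≡⟨ toℕ-vertex i ⟨
    toℕ (vertex i)     ≡⟨ cong toℕ (⊕-cancelʳ (toℕ x) (trans (rebase i) (trans eq (sym (rebase j))))) ⟩
    toℕ (vertex j)     ≡⟨ toℕ-vertex j ⟩
    j % w              ∎
    where
    open ≡-Reasoning
    rebase : ∀ i → vertex i ⊕ toℕ x ≡ x ⊕ i
    rebase i = trans (⊕-swap Fin.zero i (toℕ x)) (cong (_⊕ i) (vertex-toℕ x))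

  ⊕-injective-< : ∀ (x : Fin w) {i j} → i < w → j < w → x ⊕ i ≡ x ⊕ j → i ≡ j
  ⊕-injective-< x {i} {j} i<w j<w eq =
    trans (sym (m<n⇒m%n≡m i<w)) (trans (⊕-injective x i j eq) (m<n⇒m%n≡m j<w))

  ⊕-surjective : ∀ (x v : Fin w) → ∃ λ d → d < w × v ≡ x ⊕ d
  ⊕-surjective x v = toℕ u , toℕ<n u , sym (begin
    x ⊕ toℕ u                 ≡⟨ cong (_⊕ toℕ u) (vertex-toℕ x) ⟨
    vertex (toℕ x) ⊕ toℕ u    ≡⟨ ⊕-swap Fin.zero (toℕ x) (toℕ u) ⟩
    vertex (toℕ u) ⊕ toℕ x    ≡⟨ cong (_⊕ toℕ x) (vertex-toℕ u) ⟩
    u ⊕ toℕ x                 ≡⟨ ⊕-inverseˡ v (toℕ x) ⟩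
    v                         ∎)
    where
    open ≡-Reasoning
    u = v ⊕ (n * toℕ x)

  nonZero-factorˡ : ∀ ℓ {a} → ℓ * a ≡ w → NonZero ℓ
  nonZero-factorˡ zero ()
  nonZero-factorˡ (suc _) _ = _

  nonZero-factorʳ : ∀ ℓ {a} → ℓ * a ≡ w → NonZero a
  nonZero-factorʳ ℓ {a} ℓa≡w = nonZero-factorˡ a (trans (*-comm a ℓ) ℓa≡w)

  rotation : ℕ → Aut w
  rotation r = record
    { perm = mk↔ₛ′ (_⊕ r) (_⊕ (n * r)) (λ x → ⊕-inverseˡ x r) (λ x → ⊕-inverseʳ x r)
    ; arcs = λ u v → mk⇔ (λ v≡next-u → trans (cong (_⊕ r) v≡next-u) (⊕-swap u 1 r))
                         (λ arc → ⊕-cancelʳ r (trans arc (sym (⊕-swap u 1 r))))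
    }

  shift : Aut w → ℕ
  shift f = toℕ (app f Fin.zero)

  app-⊕ : (f : Aut w) (x : Fin w) (j : ℕ) → app f (x ⊕ j) ≡ app f x ⊕ j
  app-⊕ f x zero = refl
  app-⊕ f x (suc j) = trans (Equivalence.to (Aut.arcs f (x ⊕ j) _) refl) (cong next (app-⊕ f x j))

  automorphism-is-rotation : (f : Aut w) (x : Fin w) → app f x ≡ x ⊕ shift f
  automorphism-is-rotation f x = begin
    app f x                        ≡⟨ cong (app f) (vertex-toℕ x) ⟨
    app f (vertex (toℕ x))         ≡⟨ app-⊕ f Fin.zero (toℕ x) ⟩
    app f Fin.zero ⊕ toℕ x         ≡⟨ cong (_⊕ toℕ x) (vertex-toℕ (app f Fin.zero)) ⟨
    vertex (shift f) ⊕ toℕ x       ≡⟨ ⊕-swap Fin.zero (shift f) (toℕ x) ⟩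
    vertex (toℕ x) ⊕ shift f       ≡⟨ cong (_⊕ shift f) (vertex-toℕ x) ⟩
    x ⊕ shift f                    ∎
    where open ≡-Reasoning

  app-injective : (f : Aut w) {x y : Fin w} → app f x ≡ app f y → x ≡ y
  app-injective f {x} {y} eq = ⊕-cancelʳ (shift f)
    (trans (sym (automorphism-is-rotation f x)) (trans eq (automorphism-is-rotation f y)))

  rotation-image : ∀ r s k → ImageIs (rotation r) (s , k) (s ⊕ r , k)
  rotation-image r s k = (λ _ → mk⇔ vertex-to vertex-from) , (λ _ _ → mk⇔ arc-to arc-from)
    where
    vertex-to : ∀ {v} → (∃ λ x → InV (s , k) x × x ⊕ r ≡ v) → InV (s ⊕ r , k) v
    vertex-to (_ , (j , j<k , refl) , refl) = j , j<k , ⊕-swap s j r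
    vertex-from : ∀ {v} → InV (s ⊕ r , k) v → ∃ λ x → InV (s , k) x × x ⊕ r ≡ v
    vertex-from (j , j<k , refl) = s ⊕ j , (j , j<k , refl) , ⊕-swap s j r
    arc-to : ∀ {u v} → (∃₂ λ x y → InE (s , k) x y × x ⊕ r ≡ u × y ⊕ r ≡ v) → InE (s ⊕ r , k) u v
    arc-to (_ , _ , (j , j+1<k , refl , refl) , refl , refl) = j , j+1<k , ⊕-swap s j r , ⊕-swap s (suc j) r
    arc-from : ∀ {u v} → InE (s ⊕ r , k) u v → ∃₂ λ x y → InE (s , k) x y × x ⊕ r ≡ u × y ⊕ r ≡ v
    arc-from (j , j+1<k , refl , refl) =
      s ⊕ j , s ⊕ suc j , (j , j+1<k , refl , refl) , ⊕-swap s j r , ⊕-swap s (suc j) r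

  IsInitial : Tile w → Fin w → Set
  IsInitial t v = InV t v × (∀ u → ¬ InE t u v)

  start-isInitial : ∀ s {k} → 1 ≤ k → k ≤ w → IsInitial (s , k) s
  start-isInitial s 1≤k k≤w = (0 , 1≤k , refl) , λ where
    _ (j , j+1<k , _ , s≡s⊕[j+1]) → 0≢1+n (⊕-injective-< s (s≤s z≤n) (≤-trans j+1<k k≤w) s≡s⊕[j+1])

  isInitial⇒≡start : ∀ {s k v} → IsInitial (s , k) v → v ≡ s
  isInitial⇒≡start ((zero , _ , v≡s) , _) = v≡s
  isInitial⇒≡start {s} ((suc j , j+1<k , v≡s⊕[j+1]) , initial) =
    contradiction (j , j+1<k , refl , v≡s⊕[j+1]) (initial (s ⊕ j))

  -- The start of a path is its only vertex without an incoming path arc, and automorphisms preserve arcs.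
  image-start : (f : Aut w) {t t' : Tile w} → 1 ≤ size t → size t ≤ w →
                ImageIs f t t' → start t' ≡ app f (start t)
  image-start f {s , k} {s' , k'} 1≤k k≤w (vertices , arcs) =
    sym (isInitial⇒≡start (image-in , image-initial))
    where
    initial = start-isInitial s 1≤k k≤w
    image-in : InV (s' , k') (app f s)
    image-in = Equivalence.to (vertices (app f s)) (s , proj₁ initial , refl)
    image-initial : ∀ u → ¬ InE (s' , k') u (app f s)
    image-initial u arc with Equivalence.from (arcs u (app f s)) arc
    ... | x , y , arc' , _ , fy≡fs with app-injective f fy≡fs
    ... | refl = proj₂ initial x arc'

  module UniformTiling {ℓ a : ℕ} {S : List (Tile w)} (tiling : IsTiling w (replicate ℓ a) S) where
    open IsTiling tiling

    size≡ : ∀ {t} → t ∈ S → size t ≡ a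
    size≡ t∈S = All.lookup (replicate⁺ {P = _≡ a} ℓ refl) (∈-resp-↭ sizes (∈-map⁺ size t∈S))

    some-tile : ∃ λ s → (s , a) ∈ S
    some-tile with cover Fin.zero
    ... | (s , k) , t∈S , _ = s , subst (λ k → (s , k) ∈ S) (size≡ t∈S) t∈S

    1≤a : 1 ≤ a
    1≤a = subst (1 ≤_) (size≡ (proj₂ some-tile)) (proj₁ (valid _ (proj₂ some-tile)))

    a≤w : a ≤ w
    a≤w = subst (_≤ w) (size≡ (proj₂ some-tile)) (proj₂ (valid _ (proj₂ some-tile)))

    private instance
      a≢0 : NonZero a
      a≢0 = >-nonZero 1≤a

    overlapping-tiles : ∀ {s s' i j} → (s , a) ∈ S → (s' , a) ∈ S →
                        i < a → j < a → s ⊕ i ≡ s' ⊕ j → s ≡ s'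
    overlapping-tiles s∈S s'∈S i<a j<a eq =
      cong start (disjoint _ _ _ s∈S s'∈S (_ , i<a , refl) (_ , j<a , eq))

    -- If s ⊕ a were not the start of its tile (s' , a), that tile would also contain the last
    -- vertex s ⊕ pred a of (s , a).
    next-tile : ∀ {s} → (s , a) ∈ S → (s ⊕ a , a) ∈ S
    next-tile {s} s∈S with cover (s ⊕ a)
    ... | (s' , k) , s'∈S , covering with size≡ s'∈S
    ... | refl with covering
    ... | zero , _ , s⊕a≡s' = subst (λ v → (v , a) ∈ S) (sym s⊕a≡s') s'∈S
    ... | suc i , i+1<a , s⊕a≡s'⊕[i+1] =
      contradiction (⊕-injective-< s (<-≤-trans pred-a<a a≤w) (<-≤-trans i<a a≤w) s⊕pred-a≡s⊕i)
                    (>⇒≢ (<⇒≤pred i+1<a))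
      where
      pred-a<a : pred a < a
      pred-a<a = ≤-reflexive (suc-pred a)
      i<a : i < a
      i<a = <-trans (n<1+n i) i+1<a
      s⊕pred-a≡s'⊕i : s ⊕ pred a ≡ s' ⊕ i
      s⊕pred-a≡s'⊕i = ⊕-cancelʳ 1 (trans (cong (s ⊕_) (suc-pred a)) s⊕a≡s'⊕[i+1])
      s⊕pred-a≡s⊕i : s ⊕ pred a ≡ s ⊕ i
      s⊕pred-a≡s⊕i = trans s⊕pred-a≡s'⊕i
        (cong (_⊕ i) (sym (overlapping-tiles s∈S s'∈S pred-a<a i<a s⊕pred-a≡s'⊕i)))

    grid-∈ : ∀ {s} → (s , a) ∈ S → ∀ k → (s ⊕ (k * a) , a) ∈ S
    grid-∈ s∈S zero = s∈S
    grid-∈ {s} s∈S (suc k) = subst (λ v → (v , a) ∈ S) (⊕-+ s (k * a) a) (next-tile (grid-∈ s∈S k))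

    start-on-grid : ∀ {s t} → (s , a) ∈ S → t ∈ S → ∃ λ k → start t ≡ s ⊕ (k * a)
    start-on-grid {s} {st , kt} s∈S t∈S with size≡ t∈S | ⊕-surjective s st
    ... | refl | d , _ , st≡s⊕d = d / a , overlapping-tiles t∈S (grid-∈ s∈S (d / a)) 1≤a (m%n<n d a) (begin
      st ⊕ 0                        ≡⟨ st≡s⊕d ⟩
      s ⊕ d                         ≡⟨ cong (s ⊕_) (m≡m%n+[m/n]*n d a) ⟩
      s ⊕ (d % a + d / a * a)       ≡⟨ ⊕-+ s (d / a * a) (d % a) ⟨
      (s ⊕ (d / a * a)) ⊕ (d % a)   ∎)
      where open ≡-Reasoning

  carries-start : ∀ {ℓ a S S' s s'} (f : Aut w) →
    IsTiling w (replicate ℓ a) S → IsTiling w (replicate ℓ a) S' → (s , a) ∈ S → (s' , a) ∈ S' →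
    Carries f S S' → ∃ λ k → s ⊕ shift f ≡ s' ⊕ (k * a)
  carries-start {a = a} {s = s} {s'} f tiling tiling' s∈S s'∈S' (forward , _)
    with forward (s , a) s∈S
  ... | t' , t'∈S' , image with UniformTiling.start-on-grid tiling' s'∈S' t'∈S'
  ... | k , start≡ = k , (begin
    s ⊕ shift f   ≡⟨ automorphism-is-rotation f s ⟨
    app f s       ≡⟨ image-start f (UniformTiling.1≤a tiling) (UniformTiling.a≤w tiling) image ⟨
    start t'      ≡⟨ start≡ ⟩
    s' ⊕ (k * a)  ∎)
    where open ≡-Reasoning

  shift-divisible : ∀ {ℓ a S} (f : Aut w) → ℓ * a ≡ w → IsTiling w (replicate ℓ a) S →
    Carries f S S → a ∣ shift f % w
  shift-divisible {ℓ} {a} f ℓa≡w tiling carried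
    with UniformTiling.some-tile tiling
  ... | s , s∈S with carries-start f tiling tiling s∈S s∈S carried
  ... | k , s⊕shift≡s⊕ka = subst (a ∣_) (sym (⊕-injective s (shift f) (k * a) s⊕shift≡s⊕ka))
    (%-presˡ-∣ (n∣m*n k) (divides ℓ (sym ℓa≡w)))

  rotation-carries : ∀ {ℓ a S S' s s'} r c → ℓ * a ≡ w →
    IsTiling w (replicate ℓ a) S → IsTiling w (replicate ℓ a) S' → (s , a) ∈ S → (s' , a) ∈ S' →
    s ⊕ r ≡ s' ⊕ (c * a) → Carries (rotation r) S S'
  rotation-carries {zero} _ _ ()
  rotation-carries {suc ℓ-1} {a} {S} {S'} {s} {s'} r c ℓa≡w tiling tiling' s∈S s'∈S' s⊕r≡s'⊕ca =
    forward , backward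
    where
    open ≡-Reasoning
    module U = UniformTiling tiling
    module U' = UniformTiling tiling'

    moved : ∀ k → (s ⊕ (k * a)) ⊕ r ≡ s' ⊕ ((k + c) * a)
    moved k = begin
      (s ⊕ (k * a)) ⊕ r          ≡⟨ ⊕-swap s (k * a) r ⟩
      (s ⊕ r) ⊕ (k * a)          ≡⟨ cong (_⊕ (k * a)) s⊕r≡s'⊕ca ⟩
      (s' ⊕ (c * a)) ⊕ (k * a)   ≡⟨ ⊕-+ s' (c * a) (k * a) ⟩
      s' ⊕ (k * a + c * a)       ≡⟨ cong (s' ⊕_) (*-distribʳ-+ a k c) ⟨
      s' ⊕ ((k + c) * a)         ∎

    -- Going back c tiles is going forward c · ℓ-1 tiles, as ℓ tiles make a full turn.
    wrapped : ∀ k → s' ⊕ ((k + c * ℓ-1 + c) * a) ≡ s' ⊕ (k * a)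
    wrapped k = begin
      s' ⊕ ((k + c * ℓ-1 + c) * a)    ≡⟨ cong (s' ⊕_) (rearrange k c ℓ-1 a) ⟩
      s' ⊕ (suc ℓ-1 * a * c + k * a)  ≡⟨ cong (λ x → s' ⊕ (x * c + k * a)) ℓa≡w ⟩
      s' ⊕ (w * c + k * a)            ≡⟨ ⊕-+ s' (k * a) (w * c) ⟨
      (s' ⊕ (k * a)) ⊕ (w * c)        ≡⟨ ⊕-turns (s' ⊕ (k * a)) c ⟩
      s' ⊕ (k * a)                    ∎
      where
      rearrange : ∀ k c ℓ-1 a → (k + c * ℓ-1 + c) * a ≡ suc ℓ-1 * a * c + k * a
      rearrange = solve-∀

    forward : ∀ t → t ∈ S → ∃ λ t' → t' ∈ S' × ImageIs (rotation r) t t'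
    forward (_ , _) t∈S with U.size≡ t∈S | U.start-on-grid s∈S t∈S
    ... | refl | k , refl =
      _ , subst (λ v → (v , a) ∈ S') (sym (moved k)) (U'.grid-∈ s'∈S' (k + c)) , rotation-image r _ a

    backward : ∀ t' → t' ∈ S' → ∃ λ t → t ∈ S × ImageIs (rotation r) t t'
    backward (_ , _) t'∈S' with U'.size≡ t'∈S' | U'.start-on-grid s'∈S' t'∈S'
    ... | refl | k , refl =
      _ , U.grid-∈ s∈S (k + c * ℓ-1) ,
      subst (λ v → ImageIs (rotation r) _ (v , a)) (trans (moved (k + c * ℓ-1)) (wrapped k))
        (rotation-image r _ a)

  rotation-preserves : ∀ {ℓ a S} c → ℓ * a ≡ w → IsTiling w (replicate ℓ a) S →
                       Carries (rotation (c * a)) S S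
  rotation-preserves {a = a} c ℓa≡w tiling = rotation-carries (c * a) c ℓa≡w tiling tiling s∈S s∈S refl
    where
    s∈S = proj₂ (UniformTiling.some-tile tiling)

  grid : (ℓ a : ℕ) → Fin w → List (Tile w)
  grid ℓ a s = tabulate {n = ℓ} λ k → s ⊕ (toℕ k * a) , a

  module Grid {ℓ a : ℕ} (ℓa≡w : ℓ * a ≡ w) (s : Fin w) where
    private instance
      ℓ≢0 : NonZero ℓ
      ℓ≢0 = nonZero-factorˡ ℓ ℓa≡w
      a≢0 : NonZero a
      a≢0 = nonZero-factorʳ ℓ ℓa≡w

    tile : Fin ℓ → Tile w
    tile k = s ⊕ (toℕ k * a) , a

    offset-< : ∀ (k : Fin ℓ) {j} → j < a → j + toℕ k * a < w
    offset-< k {j} j<a = subst (j + toℕ k * a <_) ℓa≡w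
      (≤-trans (+-monoˡ-≤ (toℕ k * a) j<a) (*-monoˡ-≤ a (toℕ<n k)))

    quotient≡ : ∀ (k : Fin ℓ) {j} → j < a → (j + toℕ k * a) / a ≡ toℕ k
    quotient≡ k j<a =
      trans (+-distrib-/-∣ʳ _ (n∣m*n (toℕ k))) (cong₂ _+_ (m<n⇒m/n≡0 j<a) (m*n/n≡m (toℕ k) a))

    same-block : ∀ {k k' : Fin ℓ} {j j'} → j < a → j' < a →
                 s ⊕ (j + toℕ k * a) ≡ s ⊕ (j' + toℕ k' * a) → k ≡ k'
    same-block {k} {k'} {j} {j'} j<a j'<a eq = toℕ-injective (begin
      toℕ k                  ≡⟨ quotient≡ k j<a ⟨
      (j + toℕ k * a) / a    ≡⟨ cong (_/ a) (⊕-injective-< s (offset-< k j<a) (offset-< k' j'<a) eq) ⟩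
      (j' + toℕ k' * a) / a  ≡⟨ quotient≡ k' j'<a ⟩
      toℕ k'                 ∎)
      where open ≡-Reasoning

    isTiling : IsTiling w (replicate ℓ a) (grid ℓ a s)
    isTiling = record
      { unique   = tabulate⁺ {f = tile} λ {k} {k'} eq →
                     same-block {k} {k'} (>-nonZero⁻¹ a) (>-nonZero⁻¹ a) (cong start eq)
      ; valid    = valid
      ; cover    = cover
      ; disjoint = disjoint
      ; sizes    = ↭-reflexive (trans (map-tabulate tile size) (tabulate-const ℓ a))
      }
      where
      valid : ∀ t → t ∈ grid ℓ a s → 1 ≤ size t × size t ≤ w
      valid t t∈grid with ∈-tabulate⁻ t∈grid
      ... | _ , refl = >-nonZero⁻¹ a , subst (a ≤_) ℓa≡w (m≤n*m a ℓ)

      cover : ∀ v → ∃ λ t → t ∈ grid ℓ a s × InV t v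
      cover v with ⊕-surjective s v
      ... | d , d<w , v≡s⊕d = tile k , ∈-tabulate⁺ k , d % a , m%n<n d a , (begin
        v                              ≡⟨ v≡s⊕d ⟩
        s ⊕ d                          ≡⟨ cong (s ⊕_) (m≡m%n+[m/n]*n d a) ⟩
        s ⊕ (d % a + d / a * a)        ≡⟨ cong (λ q → s ⊕ (d % a + q * a)) (toℕ-fromℕ< d/a<ℓ) ⟨
        s ⊕ (d % a + toℕ k * a)        ≡⟨ ⊕-+ s (toℕ k * a) (d % a) ⟨
        (s ⊕ (toℕ k * a)) ⊕ (d % a)    ∎)
        where
        open ≡-Reasoning
        d/a<ℓ : d / a < ℓ
        d/a<ℓ = m<n*o⇒m/o<n (subst (d <_) (sym ℓa≡w) d<w)
        k = fromℕ< d/a<ℓ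

      disjoint : ∀ t t' v → t ∈ grid ℓ a s → t' ∈ grid ℓ a s → InV t v → InV t' v → t ≡ t'
      disjoint _ _ v t∈grid t'∈grid v∈t v∈t' with ∈-tabulate⁻ t∈grid | ∈-tabulate⁻ t'∈grid
      disjoint _ _ v _ _ (j , j<a , v≡) (j' , j'<a , v≡') | k , refl | k' , refl =
        cong tile (same-block {k} {k'} j<a j'<a (begin
          s ⊕ (j + toℕ k * a)         ≡⟨ ⊕-+ s (toℕ k * a) j ⟨
          (s ⊕ (toℕ k * a)) ⊕ j       ≡⟨ v≡ ⟨
          v                           ≡⟨ v≡' ⟩
          (s ⊕ (toℕ k' * a)) ⊕ j'     ≡⟨ ⊕-+ s (toℕ k' * a) j' ⟩
          s ⊕ (j' + toℕ k' * a)       ∎))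
        where open ≡-Reasoning

    start-∈ : (s , a) ∈ grid ℓ a s
    start-∈ = subst (λ q → (s ⊕ (q * a) , a) ∈ grid ℓ a s) (toℕ-fromℕ< 0<ℓ) (∈-tabulate⁺ (fromℕ< 0<ℓ))
      where
      0<ℓ = >-nonZero⁻¹ ℓ

  module Classification {a b ℓ m : ℕ} (ℓa≡w : ℓ * a ≡ w) (mb≡w : m * b ≡ w) where
    private instance
      a≢0 : NonZero a
      a≢0 = nonZero-factorʳ ℓ ℓa≡w
      b≢0 : NonZero b
      b≢0 = nonZero-factorʳ m mb≡w
      g≢0 : NonZero (gcd a b)
      g≢0 = gcd≢0 a b

    g : ℕ
    g = gcd a b

    g∣w : g ∣ w
    g∣w = ∣-trans (gcd[m,n]∣m a b) (divides ℓ (sym ℓa≡w))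

    Tiling : Set
    Tiling = BiTiling w (replicate ℓ a) (replicate m b)

    module S-grid = Grid {ℓ} {a} ℓa≡w Fin.zero
    module T-grid (i : Fin g) = Grid {m} {b} mb≡w (vertex (toℕ i))

    standard : Fin g → Tiling
    standard i = bitiling (grid ℓ a Fin.zero) (grid m b (vertex (toℕ i))) S-grid.isTiling (T-grid.isTiling i)

    -- An isomorphism is a rotation by some r with r ≡ 0 (mod a) and i + r ≡ j (mod b) (mod w);
    -- reduce modulo g.
    standard-injective : ∀ i j → Iso (standard i) (standard j) → i ≡ j
    standard-injective i j (f , S-carried , T-carried)
      with carries-start f (T-grid.isTiling i) (T-grid.isTiling j) (T-grid.start-∈ i) (T-grid.start-∈ j) T-carried
    ... | k , i⊕r≡j⊕kb = toℕ-injective (begin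
      toℕ i                  ≡⟨ m<n⇒m%n≡m (toℕ<n i) ⟨
      toℕ i % g              ≡⟨ %-remove-+ˡ (toℕ i) g∣r ⟨
      (r + toℕ i) % g        ≡⟨ %-≡-divisor (r + toℕ i) (k * b + toℕ j) g∣w r+i≡kb+j[mod-w] ⟩
      (k * b + toℕ j) % g    ≡⟨ %-remove-+ˡ (toℕ j) (∣n⇒∣m*n k (gcd[m,n]∣n a b)) ⟩
      toℕ j % g              ≡⟨ m<n⇒m%n≡m (toℕ<n j) ⟩
      toℕ j                  ∎)
      where
      open ≡-Reasoning
      r = shift f
      g∣r : g ∣ r
      g∣r = ∣n∣m%n⇒∣m g∣w (∣-trans (gcd[m,n]∣m a b) (shift-divisible f ℓa≡w S-grid.isTiling S-carried))
      r+i≡kb+j[mod-w] : (r + toℕ i) % w ≡ (k * b + toℕ j) % w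
      r+i≡kb+j[mod-w] = ⊕-injective Fin.zero (r + toℕ i) (k * b + toℕ j)
        (trans (sym (⊕-+ Fin.zero (toℕ i) r)) (trans i⊕r≡j⊕kb (⊕-+ Fin.zero (toℕ j) (k * b))))

    -- With d = n·s + t ≡ t − s (mod w) and Bézout u·a + (d / g)·g = k·b, the rotation by
    -- u·a − s moves s to the grid point u·a and t to vertex (d % g) plus k·b.
    standard-surjective : ∀ P → ∃ λ i → Iso P (standard i)
    standard-surjective (bitiling S T S-tiling T-tiling)
      with UniformTiling.some-tile S-tiling | UniformTiling.some-tile T-tiling
    ... | s , s∈S | t , t∈T = i , rotation R ,
      rotation-carries R u ℓa≡w S-tiling S-grid.isTiling s∈S S-grid.start-∈ s⊕R≡ua ,
      rotation-carries R k mb≡w T-tiling (T-grid.isTiling i) t∈T (T-grid.start-∈ i) t⊕R≡i⊕kb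
      where
      open ≡-Reasoning
      d = n * toℕ s + toℕ t
      i : Fin g
      i = fromℕ< (m%n<n d g)
      bézout = u*a+q*gcd≡k*b a b (d / g)
      u = proj₁ bézout
      k = proj₁ (proj₂ bézout)
      R = u * a + n * toℕ s

      s⊕R≡ua : s ⊕ R ≡ Fin.zero ⊕ (u * a)
      s⊕R≡ua = begin
        s ⊕ (u * a + n * toℕ s)        ≡⟨ ⊕-+ s (n * toℕ s) (u * a) ⟨
        (s ⊕ (n * toℕ s)) ⊕ (u * a)    ≡⟨ cong (_⊕ (u * a)) (⊕-negate s) ⟩
        Fin.zero ⊕ (u * a)             ∎

      ua+d≡kb+i : u * a + d ≡ k * b + toℕ i
      ua+d≡kb+i = begin
        u * a + d                      ≡⟨ cong (u * a +_) (m≡m%n+[m/n]*n d g) ⟩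
        u * a + (d % g + d / g * g)    ≡⟨ cong (u * a +_) (+-comm (d % g) (d / g * g)) ⟩
        u * a + (d / g * g + d % g)    ≡⟨ +-assoc (u * a) (d / g * g) (d % g) ⟨
        u * a + d / g * g + d % g      ≡⟨ cong₂ _+_ (proj₂ (proj₂ bézout)) (sym (toℕ-fromℕ< (m%n<n d g))) ⟩
        k * b + toℕ i                  ∎

      t⊕R≡i⊕kb : t ⊕ R ≡ vertex (toℕ i) ⊕ (k * b)
      t⊕R≡i⊕kb = begin
        t ⊕ (u * a + n * toℕ s)              ≡⟨ cong (_⊕ (u * a + n * toℕ s)) (vertex-toℕ t) ⟨
        vertex (toℕ t) ⊕ (u * a + n * toℕ s) ≡⟨ ⊕-+ Fin.zero (toℕ t) (u * a + n * toℕ s) ⟩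
        vertex (u * a + n * toℕ s + toℕ t)   ≡⟨ cong vertex (+-assoc (u * a) (n * toℕ s) (toℕ t)) ⟩
        vertex (u * a + d)                   ≡⟨ cong vertex ua+d≡kb+i ⟩
        vertex (k * b + toℕ i)               ≡⟨ ⊕-+ Fin.zero (toℕ i) (k * b) ⟨
        vertex (toℕ i) ⊕ (k * b)             ∎

    isoClasses : HasNClasses Tiling Iso g
    isoClasses = standard , standard-injective , standard-surjective

  module Symmetries {a b ℓ m : ℕ} (ℓa≡w : ℓ * a ≡ w) (mb≡w : m * b ≡ w)
                    (P : BiTiling w (replicate ℓ a) (replicate m b)) where
    open BiTiling P

    private instance
      a≢0 : NonZero a
      a≢0 = nonZero-factorʳ ℓ ℓa≡w
      ℓ≢0 : NonZero ℓ
      ℓ≢0 = nonZero-factorˡ ℓ ℓa≡w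
      h≢0 : NonZero (gcd ℓ m)
      h≢0 = gcd≢0 ℓ m
      p≢0 : NonZero (ℓ / gcd ℓ m * a)
      p≢0 = m*n≢0 (ℓ / gcd ℓ m) a {{≢-nonZero (m/gcd[m,n]≢0 ℓ m)}}

    h e f : ℕ
    h = gcd ℓ m
    e = ℓ / h
    f = m / h

    -- p = e·a = f·b is the least common multiple of a and b.
    p : ℕ
    p = e * a

    e*a≡f*b : e * a ≡ f * b
    e*a≡f*b = *-cancelʳ-≡ (e * a) (f * b) h (begin
      e * a * h    ≡⟨ x*y*z≡x*z*y e a h ⟩
      e * h * a    ≡⟨ cong (_* a) (m/n*n≡m (gcd[m,n]∣m ℓ m)) ⟩
      ℓ * a        ≡⟨ trans ℓa≡w (sym mb≡w) ⟩
      m * b        ≡⟨ cong (_* b) (m/n*n≡m (gcd[m,n]∣n ℓ m)) ⟨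
      f * h * b    ≡⟨ x*y*z≡x*z*y f h b ⟩
      f * b * h    ∎)
      where
      open ≡-Reasoning
      x*y*z≡x*z*y : ∀ x y z → x * y * z ≡ x * z * y
      x*y*z≡x*z*y = solve-∀

    h*p≡w : h * p ≡ w
    h*p≡w = begin
      h * (e * a)  ≡⟨ *-assoc h e a ⟨
      h * e * a    ≡⟨ cong (_* a) (*-comm h e) ⟩
      e * h * a    ≡⟨ cong (_* a) (m/n*n≡m (gcd[m,n]∣m ℓ m)) ⟩
      ℓ * a        ≡⟨ ℓa≡w ⟩
      w            ∎
      where open ≡-Reasoning

    rotationSymmetry : Fin h → AutOf P
    rotationSymmetry j = rotation (toℕ j * p) ,
      subst (λ r → Carries (rotation r) S S) (*-assoc (toℕ j) e a)
        (rotation-preserves (toℕ j * e) ℓa≡w S-tiling) ,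
      subst (λ r → Carries (rotation r) T T) jf*b≡jp (rotation-preserves (toℕ j * f) mb≡w T-tiling)
      where
      jf*b≡jp : toℕ j * f * b ≡ toℕ j * p
      jf*b≡jp = trans (*-assoc (toℕ j) f b) (cong (toℕ j *_) (sym e*a≡f*b))

    jp<w : ∀ (j : Fin h) → toℕ j * p < w
    jp<w j = subst (toℕ j * p <_) h*p≡w (*-monoˡ-< p (toℕ<n j))

    rotationSymmetry-injective : ∀ j j' → SameAut {P = P} (rotationSymmetry j) (rotationSymmetry j') →
                                 j ≡ j'
    rotationSymmetry-injective j j' same = toℕ-injective
      (*-cancelʳ-≡ (toℕ j) (toℕ j') p (⊕-injective-< Fin.zero (jp<w j) (jp<w j') (same Fin.zero)))

    -- The shift is a multiple of both a and b modulo w, hence of p, and w = h·p.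
    rotationSymmetry-surjective : ∀ F → ∃ λ j → SameAut {P = P} F (rotationSymmetry j)
    rotationSymmetry-surjective F@(f , S-carried , T-carried) = fromℕ< k<h , λ x → begin
      app f x                      ≡⟨ automorphism-is-rotation f x ⟩
      x ⊕ shift f                  ≡⟨ ⊕-cong-% x (shift f % w) (shift f) (m%n%n≡m%n (shift f) w) ⟨
      x ⊕ (shift f % w)            ≡⟨ cong (x ⊕_) (_∣_.equality p∣shift) ⟩
      x ⊕ (k * p)                  ≡⟨ cong (λ q → x ⊕ (q * p)) (toℕ-fromℕ< k<h) ⟨
      x ⊕ (toℕ (fromℕ< k<h) * p)   ∎
      where
      open ≡-Reasoning
      p∣shift : p ∣ shift f % w
      p∣shift = coprime-common-multiple-∣ (coprime-/gcd ℓ m) e*a≡f*b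
        (shift-divisible f ℓa≡w S-tiling S-carried) (shift-divisible f mb≡w T-tiling T-carried)
      k = _∣_.quotient p∣shift
      k<h : k < h
      k<h = *-cancelʳ-< p k h (subst₂ _<_ (_∣_.equality p∣shift) (sym h*p≡w) (m%n<n (shift f) w))

    automorphisms : HasNClasses (AutOf P) (SameAut {P = P}) h
    automorphisms = rotationSymmetry , rotationSymmetry-injective , rotationSymmetry-surjective

-- 1 ≤ a, 1 ≤ b, 1 ≤ ℓ and 1 ≤ m are unused: they follow from ℓ * a ≡ w ≡ m * b and 1 ≤ w.
proposition2p5 : (a b ℓ m w : ℕ) → 1 ≤ a → 1 ≤ b → 1 ≤ ℓ → 1 ≤ m → 1 ≤ w →
    ℓ * a ≡ w → m * b ≡ w →
    HasNClasses (BiTiling w (replicate ℓ a) (replicate m b)) Iso (gcd a b) ×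
    ((P : BiTiling w (replicate ℓ a) (replicate m b)) →
      HasNClasses (AutOf P) (SameAut {P = P}) (gcd ℓ m))
proposition2p5 _ _ _ _ zero _ _ _ _ () _ _
proposition2p5 a b ℓ m (suc n) _ _ _ _ _ ℓa≡w mb≡w =
  Classification.isoClasses ℓa≡w mb≡w , Symmetries.automorphisms ℓa≡w mb≡w
  where open Cycle n
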